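{- Let $\mathcal{C}=\langle A;S;T;\theta\rangle$ be a configuration (over an absorption theory $\mathtt{Abs}$). Then any quadruple $\mathcal{C}'=\langle A';S';T';\theta'\rangle$ derived from $\mathcal{C}$ by the rules of $\textsc{AUnif}$ is again a configuration.
   Context: Terms are built over a countable set of variables $\mathcal{V}$ and a set $\mathcal{F}$ of function symbols with arities, which contains a special constant $\star$ (the wild card). $head(x)=x$ for a variable and $head(f(t_1,\dots,t_n))=f$. Substitutions are written in postfix notation ($t\sigma$), $\sigma\theta$ means first $\sigma$ then $\theta$; $\mathit{Dom}(\sigma)=\{x\mid x\sigma\neq x\}$ and $\mathit{Rvar}(\sigma)$ is the set of variables occurring in $\{x\sigma\mid x\in\mathit{Dom}(\sigma)\}$. An absorption theory $\mathtt{Abs}$ is a finite union of axiom sets $\{f(x,\varepsilon_f)\approx\varepsilon_f,\ f(\varepsilon_f,x)\approx\varepsilon_f\}$ for pairwise distinct binary symbols $f$ with associated constants $\varepsilon_f$ (the absorption constant of $f$); $f$ and $\varepsilon_f$ are called related absorption symbols. A term is in $\mathtt{Abs}$-normal form if no absorption constant $\varepsilon_f$ occurs as an argument of $f$. An anti-unification equation (AUE) is a triple $s\triangleq_x t$ with $x\in\mathcal{V}$ (its label) and terms $s,t$; $labels(W)$ is the set of labels of a set $W$ of AUEs, and $W$ is valid if its AUEs have pairwise distinct labels. An AUE is wild if one of its sides is $\star$. It is solved if $head(s)\neq head(t)$, $head(s)$ and $head(t)$ are not related absorption symbols, and it is not wild. A configuration is a quadruple $\langle A;S;T;\theta\rangle$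 where $A$ is a valid set of AUEs, $S$ (the store) is a valid set of solved AUEs, $T$ (the abstraction) is a valid set of wild AUEs, and $\theta$ is a substitution, such that all terms occurring are in $\mathtt{Abs}$-normal form, the sets $labels(A),labels(S),labels(T),\mathit{Dom}(\theta)$ are pairwise disjoint, and $\mathit{Rvar}(\theta)=labels(A)\cup labels(S)\cup labels(T)$. The rules of $\textsc{AUnif}$ ($\uplus$ is disjoint union; all $y_i$ are fresh variables; $f$ in the Exp rules is an absorption symbol): (Dec) $\langle\{f(s_1,\dots,s_n)\triangleq_x f(t_1,\dots,t_n)\}\uplus A;S;T;\theta\rangle\Longrightarrow\langle\{s_1\triangleq_{y_1}t_1,\dots,s_n\triangleq_{y_n}t_n\}\cup A;S;T;\theta\{x\mapsto f(y_1,\dots,y_n)\}\rangle$, $n\ge 0$. (Sol) $\langle\{s\triangleq_x t\}\uplus A;S;T;\theta\rangle\Longrightarrow\langle A;\{s\triangleq_x t\}\cup S;T;\theta\rangle$ if $head(s)\neq head(t)$ and they are not related absorption symbols. (ExpLA1) $\langle\{\varepsilon_f\triangleq_x f(t_1,t_2)\}\uplus A;S;T;\theta\rangle\Longrightarrow\langle\{\varepsilon_f\triangleq_{y_1}t_1\}\cup A;S;\{\star\triangleq_{y_2}t_2\}\cup T;\theta\{x\mapsto f(y_1,y_2)\}\rangle$. (ExpLA2) $\langle\{\varepsilon_f\triangleq_x f(t_1,t_2)\}\uplus A;S;T;\theta\rangle\Longrightarrow\langle\{\varepsilon_f\triangleq_{y_2}t_2\}\cup A;S;\{\star\triangleq_{y_1}t_1\}\cup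 T;\theta\{x\mapsto f(y_1,y_2)\}\rangle$. (ExpRA1) $\langle\{f(s_1,s_2)\triangleq_x\varepsilon_f\}\uplus A;S;T;\theta\rangle\Longrightarrow\langle\{s_1\triangleq_{y_1}\varepsilon_f\}\cup A;S;\{s_2\triangleq_{y_2}\star\}\cup T;\theta\{x\mapsto f(y_1,y_2)\}\rangle$. (ExpRA2) $\langle\{f(s_1,s_2)\triangleq_x\varepsilon_f\}\uplus A;S;T;\theta\rangle\Longrightarrow\langle\{s_2\triangleq_{y_2}\varepsilon_f\}\cup A;S;\{s_1\triangleq_{y_1}\star\}\cup T;\theta\{x\mapsto f(y_1,y_2)\}\rangle$. (Mer) $\langle\emptyset;\{s\triangleq_x t,s\triangleq_y t\}\cup S;T;\theta\rangle\Longrightarrow\langle\emptyset;\{s\triangleq_y t\}\cup S;T;\theta\{x\mapsto y\}\rangle$.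
   Formalization: The wild card ⋆ does not occur in the terms of A of $\mathcal{C}$, and Abs-normal form concerns only terms of the AUEs in A, S, T, not those in the range of θ. The statement above fails without it. -}

module Defs where

open import Data.Nat using (ℕ; zero; suc; _≟_)
open import Data.Product using (Σ; ∃; ∃₂; _×_; _,_; proj₁)
open import Data.Sum using (_⊎_)
open import Data.List as List using (List; []; _∷_; _++_)
open import Data.List.Membership.Propositional using (_∈_; _∉_)
open import Data.List.Relation.Unary.All as LAll using ()
open import Data.List.Relation.Unary.Unique.Propositional using (Unique)
open import Data.List.Relation.Binary.Disjoint.Propositional using (Disjoint)
open import Data.List.Relation.Binary.Permutation.Propositional using (_↭_)
open import Data.Vec as Vec using (Vec; []; _∷_; toList)
open import Data.Vec.Relation.Unary.Any as VAny using ()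
open import Data.Vec.Relation.Unary.All as VAll using ()
open import Relation.Nullary using (¬_; yes; no)
open import Relation.Binary.PropositionalEquality using (_≡_; _≢_; subst; sym)

record Signature : Set₁ where
  field
    Fun     : Set
    arity   : Fun → ℕ
    ⋆       : Fun
    ⋆-const : arity ⋆ ≡ 0

-- The axioms f(x,ε_f) ≈ ε_f, f(ε_f,x) ≈ ε_f are determined by these pairs.

record AbsTheory (sig : Signature) : Set where
  open Signature sig
  field
    pairs    : List (Fun × Fun)
    binary   : ∀ {f e} → (f , e) ∈ pairs → arity f ≡ 2
    constant : ∀ {f e} → (f , e) ∈ pairs → arity e ≡ 0
    distinct : Unique (List.map proj₁ pairs)

module AU (sig : Signature) (ab : AbsTheory sig) where
  open Signature sig
  open AbsTheory ab

  data Term : Set where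
    var : ℕ → Term
    fun : (f : Fun) → Vec Term (arity f) → Term

  const : (c : Fun) → arity c ≡ 0 → Term
  const c p = fun c (subst (Vec Term) (sym p) [])

  bin : (f : Fun) → arity f ≡ 2 → Term → Term → Term
  bin f p t₁ t₂ = fun f (subst (Vec Term) (sym p) (t₁ ∷ t₂ ∷ []))

  starT : Term
  starT = const ⋆ ⋆-const

  data Head : Set where
    hvar : ℕ → Head
    hfun : Fun → Head

  head : Term → Head
  head (var x)    = hvar x
  head (fun f ts) = hfun f

  data _occursIn_ (x : ℕ) : Term → Set where
    here  : x occursIn var x
    there : ∀ {f ts} → VAny.Any (x occursIn_) ts → x occursIn fun f ts

  data _symIn_ (c : Fun) : Term → Set where
    here  : ∀ {ts} → c symIn fun c ts
    there : ∀ {f ts} → VAny.Any (c symIn_) ts → c symIn fun f ts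

  data NF : Term → Set where
    var : ∀ {x} → NF (var x)
    fun : ∀ {f ts} → VAll.All NF ts
        → (∀ {e} (m : (f , e) ∈ pairs) → ¬ VAny.Any (λ t → t ≡ const e (constant m)) ts)
        → NF (fun f ts)

  -- Substitutions (postfix application, σ ⨾ τ = first σ then τ)

  Subst : Set
  Subst = ℕ → Term

  mutual
    _⟪_⟫ : Term → Subst → Term
    var x ⟪ σ ⟫    = σ x
    fun f ts ⟪ σ ⟫ = fun f (substs ts σ)

    substs : ∀ {n} → Vec Term n → Subst → Vec Term n
    substs []       σ = []
    substs (t ∷ ts) σ = (t ⟪ σ ⟫) ∷ substs ts σ

  _⨾_ : Subst → Subst → Subst
  (σ ⨾ τ) x = σ x ⟪ τ ⟫

  [_↦_] : ℕ → Term → Subst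
  [ x ↦ t ] z with z ≟ x
  ... | yes _ = t
  ... | no  _ = var z

  Dom : Subst → ℕ → Set
  Dom σ x = σ x ≢ var x

  Rvar : Subst → ℕ → Set
  Rvar σ z = ∃ λ x → Dom σ x × z occursIn σ x

  FiniteDom : Subst → Set
  FiniteDom σ = ∃ λ (l : List ℕ) → ∀ x → Dom σ x → x ∈ l

  record AUE : Set where
    constructor _≜[_]_
    field
      lhs : Term
      lab : ℕ
      rhs : Term
  open AUE public

  labels : List AUE → List ℕ
  labels = List.map lab

  Valid : List AUE → Set
  Valid W = Unique (labels W)

  Related : Head → Head → Set
  Related h h' = ∃₂ λ f e → (f , e) ∈ pairs ×
    ((h ≡ hfun f × h' ≡ hfun e) ⊎ (h ≡ hfun e × h' ≡ hfun f))

  Wild : AUE → Set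
  Wild a = lhs a ≡ starT ⊎ rhs a ≡ starT

  Solved : AUE → Set
  Solved a = head (lhs a) ≢ head (rhs a)
           × ¬ Related (head (lhs a)) (head (rhs a))
           × ¬ Wild a

  -- Quadruples ⟨A;S;T;θ⟩ (sets of AUEs represented by lists)

  record Quad : Set where
    constructor ⟨_﹔_﹔_﹔_⟩
    field
      A S T : List AUE
      θ     : Subst

  allAUEs : Quad → List AUE
  allAUEs ⟨ A ﹔ S ﹔ T ﹔ θ ⟩ = A ++ S ++ T

  record IsConfiguration (C : Quad) : Set where
    open Quad C
    field
      validA   : Valid A
      validS   : Valid S
      validT   : Valid T
      solvedS  : LAll.All Solved S
      wildT    : LAll.All Wild T
      normal   : LAll.All (λ a → NF (lhs a) × NF (rhs a)) (allAUEs C)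
      disjAS   : Disjoint (labels A) (labels S)
      disjAT   : Disjoint (labels A) (labels T)
      disjST   : Disjoint (labels S) (labels T)
      disjDom  : ∀ z → z ∈ labels (allAUEs C) → ¬ Dom θ z
      rvar⇒lab : ∀ z → Rvar θ z → z ∈ labels (allAUEs C)
      lab⇒rvar : ∀ z → z ∈ labels (allAUEs C) → Rvar θ z
      finite   : FiniteDom θ

  Fresh : Quad → ℕ → Set
  Fresh C y = y ∉ labels (allAUEs C)
            × ¬ Dom (Quad.θ C) y
            × ¬ Rvar (Quad.θ C) y
            × LAll.All (λ a → ¬ y occursIn lhs a × ¬ y occursIn rhs a) (allAUEs C)

  decAUEs : ∀ {n} → Vec Term n → Vec ℕ n → Vec Term n → List AUE
  decAUEs []       []       []       = []
  decAUEs (s ∷ ss) (y ∷ ys) (t ∷ ts) = (s ≜[ y ] t) ∷ decAUEs ss ys ts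

  data _⟹_ : Quad → Quad → Set where
    Dec : ∀ {A A₀ S T θ f ss ts x} (ys : Vec ℕ (arity f))
        → A ↭ (fun f ss ≜[ x ] fun f ts) ∷ A₀
        → Unique (toList ys)
        → VAll.All (Fresh ⟨ A ﹔ S ﹔ T ﹔ θ ⟩) ys
        → ⟨ A ﹔ S ﹔ T ﹔ θ ⟩ ⟹
          ⟨ decAUEs ss ys ts ++ A₀ ﹔ S ﹔ T ﹔ θ ⨾ [ x ↦ fun f (Vec.map var ys) ] ⟩
    Sol : ∀ {A A₀ S T θ a}
        → A ↭ a ∷ A₀
        → head (lhs a) ≢ head (rhs a)
        → ¬ Related (head (lhs a)) (head (rhs a))
        → ⟨ A ﹔ S ﹔ T ﹔ θ ⟩ ⟹ ⟨ A₀ ﹔ a ∷ S ﹔ T ﹔ θ ⟩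
    ExpLA1 : ∀ {A A₀ S T θ f e x y₁ y₂ t₁ t₂} (m : (f , e) ∈ pairs)
        → A ↭ (const e (constant m) ≜[ x ] bin f (binary m) t₁ t₂) ∷ A₀
        → y₁ ≢ y₂
        → Fresh ⟨ A ﹔ S ﹔ T ﹔ θ ⟩ y₁ → Fresh ⟨ A ﹔ S ﹔ T ﹔ θ ⟩ y₂
        → ⟨ A ﹔ S ﹔ T ﹔ θ ⟩ ⟹
          ⟨ (const e (constant m) ≜[ y₁ ] t₁) ∷ A₀ ﹔ S ﹔ (starT ≜[ y₂ ] t₂) ∷ T
          ﹔ θ ⨾ [ x ↦ bin f (binary m) (var y₁) (var y₂) ] ⟩
    ExpLA2 : ∀ {A A₀ S T θ f e x y₁ y₂ t₁ t₂} (m : (f , e) ∈ pairs)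
        → A ↭ (const e (constant m) ≜[ x ] bin f (binary m) t₁ t₂) ∷ A₀
        → y₁ ≢ y₂
        → Fresh ⟨ A ﹔ S ﹔ T ﹔ θ ⟩ y₁ → Fresh ⟨ A ﹔ S ﹔ T ﹔ θ ⟩ y₂
        → ⟨ A ﹔ S ﹔ T ﹔ θ ⟩ ⟹
          ⟨ (const e (constant m) ≜[ y₂ ] t₂) ∷ A₀ ﹔ S ﹔ (starT ≜[ y₁ ] t₁) ∷ T
          ﹔ θ ⨾ [ x ↦ bin f (binary m) (var y₁) (var y₂) ] ⟩
    ExpRA1 : ∀ {A A₀ S T θ f e x y₁ y₂ s₁ s₂} (m : (f , e) ∈ pairs)
        → A ↭ (bin f (binary m) s₁ s₂ ≜[ x ] const e (constant m)) ∷ A₀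
        → y₁ ≢ y₂
        → Fresh ⟨ A ﹔ S ﹔ T ﹔ θ ⟩ y₁ → Fresh ⟨ A ﹔ S ﹔ T ﹔ θ ⟩ y₂
        → ⟨ A ﹔ S ﹔ T ﹔ θ ⟩ ⟹
          ⟨ (s₁ ≜[ y₁ ] const e (constant m)) ∷ A₀ ﹔ S ﹔ (s₂ ≜[ y₂ ] starT) ∷ T
          ﹔ θ ⨾ [ x ↦ bin f (binary m) (var y₁) (var y₂) ] ⟩
    ExpRA2 : ∀ {A A₀ S T θ f e x y₁ y₂ s₁ s₂} (m : (f , e) ∈ pairs)
        → A ↭ (bin f (binary m) s₁ s₂ ≜[ x ] const e (constant m)) ∷ A₀
        → y₁ ≢ y₂
        → Fresh ⟨ A ﹔ S ﹔ T ﹔ θ ⟩ y₁ → Fresh ⟨ A ﹔ S ﹔ T ﹔ θ ⟩ y₂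
        → ⟨ A ﹔ S ﹔ T ﹔ θ ⟩ ⟹
          ⟨ (s₂ ≜[ y₂ ] const e (constant m)) ∷ A₀ ﹔ S ﹔ (s₁ ≜[ y₁ ] starT) ∷ T
          ﹔ θ ⨾ [ x ↦ bin f (binary m) (var y₁) (var y₂) ] ⟩
    Mer : ∀ {S S₀ T θ s t x y}
        → S ↭ (s ≜[ x ] t) ∷ (s ≜[ y ] t) ∷ S₀
        → ⟨ [] ﹔ S ﹔ T ﹔ θ ⟩ ⟹ ⟨ [] ﹔ (s ≜[ y ] t) ∷ S₀ ﹔ T ﹔ θ ⨾ [ x ↦ var y ] ⟩

  StarFreeA : Quad → Set
  StarFreeA C = LAll.All (λ a → ¬ ⋆ symIn lhs a × ¬ ⋆ symIn rhs a) (Quad.A C)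

{-# OPTIONS --safe #-}
-- The label conditions of a configuration say that the labels of A, S and T are pairwise
-- distinct, disjoint from Dom θ, and are exactly Rvar θ.  Sol only moves an AUE from A to S,
-- so these lists are merely permuted.  Every other rule removes the AUE with some label x and
-- composes θ with {x ↦ r}, where the variables of r are the labels of the new AUEs (Dec, Exp),
-- which are fresh, or the surviving label y (Mer).  Composing with such a binding replaces x by
-- the variables of r in Rvar θ and enlarges Dom θ by x only, so the conditions survive.  That
-- an AUE moved to the store by Sol is not wild needs the wild card to be absent from A; this
-- holds initially and is preserved, since the rules only put subterms of A's terms into A.
module Submission where

open import Defs
open import Relation.Binary.Construct.Closure.ReflexiveTransitive using (Star; ε; _◅_)
open import Data.Nat using (ℕ; _≟_)
open import Data.Product using (∃; _×_; _,_; proj₁; proj₂)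
open import Data.Sum using (_⊎_; inj₁; inj₂)
open import Function using (_∘_)
open import Relation.Nullary using (¬_; yes; no; contradiction)
open import Relation.Binary.PropositionalEquality
  using (_≡_; _≢_; refl; sym; trans; cong; subst; setoid)
open import Data.List using (List; []; _∷_; _++_)
open import Data.List.Properties using (map-++; ++-assoc)
open import Data.List.Membership.Propositional using (_∈_)
open import Data.List.Membership.Propositional.Properties using (∈-++⁺ˡ; ∈-++⁺ʳ; ∈-++⁻)
open import Data.List.Relation.Unary.Any using (here; there)
open import Data.List.Relation.Unary.All as All using (All; []; _∷_)
import Data.List.Relation.Unary.All.Properties as All
open import Data.List.Relation.Unary.AllPairs using ([]; _∷_)
open import Data.List.Relation.Unary.Unique.Propositional using (Unique)
open import Data.List.Relation.Unary.Unique.Propositional.Properties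
  using (Unique[x∷xs]⇒x∉xs) renaming (++⁺ to Unique-++⁺)
open import Data.List.Relation.Binary.Disjoint.Propositional using (Disjoint)
open import Data.List.Relation.Binary.Permutation.Propositional
  using (_↭_; ↭-refl; ↭-sym; ↭-trans; ↭-swap; ↭-reflexive; ↭⇒↭ₛ; module PermutationReasoning)
open import Data.List.Relation.Binary.Permutation.Propositional.Properties
  using (map⁺; shift; shifts; ++⁺ˡ; ++⁺ʳ; ∈-resp-↭; All-resp-↭)
import Data.List.Relation.Binary.Permutation.Setoid.Properties as Permutationₛ
open import Data.Vec as Vec using (Vec; []; _∷_; toList)
open import Data.Vec.Relation.Unary.Any as VAny using (here; there)
open import Data.Vec.Relation.Unary.All as VAll using ([]; _∷_)
import Data.Vec.Relation.Unary.All.Properties as VAll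

private
  variable
    X : Set
    x : X
    xs ys zs : List X

Unique-resp-↭ : xs ↭ ys → Unique xs → Unique ys
Unique-resp-↭ = Permutationₛ.Unique-resp-↭ (setoid _) ∘ ↭⇒↭ₛ

Unique-++⁻ : ∀ (xs : List X) → Unique (xs ++ ys) → Unique xs × Unique ys × Disjoint xs ys
Unique-++⁻ []       u          = [] , u , λ { (() , _) }
Unique-++⁻ (x ∷ xs) (x∉ ∷ u) with Unique-++⁻ xs u
... | uxs , uys , xs#ys = All.++⁻ˡ xs x∉ ∷ uxs , uys , λ where
  (here refl , x∈ys) → All.All¬⇒¬Any (All.++⁻ʳ xs x∉) x∈ys
  (there v∈xs , v∈ys) → xs#ys (v∈xs , v∈ys)

Disjoint-++⁺ʳ : Disjoint xs ys → Disjoint xs zs → Disjoint xs (ys ++ zs)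
Disjoint-++⁺ʳ {ys = ys} xs#ys xs#zs (v∈xs , v∈ys++zs) with ∈-++⁻ ys v∈ys++zs
... | inj₁ v∈ys = xs#ys (v∈xs , v∈ys)
... | inj₂ v∈zs = xs#zs (v∈xs , v∈zs)

Disjoint-++⁻ʳ : Disjoint xs (ys ++ zs) → Disjoint xs ys × Disjoint xs zs
Disjoint-++⁻ʳ {ys = ys} xs#ys++zs =
  (λ (v∈xs , v∈ys) → xs#ys++zs (v∈xs , ∈-++⁺ˡ v∈ys)) ,
  (λ (v∈xs , v∈zs) → xs#ys++zs (v∈xs , ∈-++⁺ʳ ys v∈zs))

All-↭-∷⁻ : {P : X → Set} → xs ↭ x ∷ ys → All P xs → P x × All P ys
All-↭-∷⁻ xs↭x∷ys pxs with All-resp-↭ xs↭x∷ys pxs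
... | px ∷ pys = px , pys

¬Any⇒All¬ᵥ : ∀ {n} {P : X → Set} (vs : Vec X n) → ¬ VAny.Any P vs → VAll.All (¬_ ∘ P) vs
¬Any⇒All¬ᵥ []       _   = []
¬Any⇒All¬ᵥ (v ∷ vs) ¬pv = ¬pv ∘ here ∷ ¬Any⇒All¬ᵥ vs (¬pv ∘ there)

module _ (sig : Signature) (ab : AbsTheory sig) where
  open Signature sig
  open AbsTheory ab
  open AU sig ab

  private
    variable
      n : ℕ
      y z : ℕ
      f c : Fun
      r s t t₁ t₂ : Term
      σ θ : Subst
      e : AUE
      A A₀ S S₀ T : List AUE
      L N : List ℕ

  Any-pair⁺ : ∀ {m} {P : Term → Set} (p : m ≡ 2) → P t₁ ⊎ P t₂
            → VAny.Any P (subst (Vec Term) (sym p) (t₁ ∷ t₂ ∷ []))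
  Any-pair⁺ refl (inj₁ pt₁) = here pt₁
  Any-pair⁺ refl (inj₂ pt₂) = there (here pt₂)

  All-pair⁻ : ∀ {m} {P : Term → Set} (p : m ≡ 2)
            → VAll.All P (subst (Vec Term) (sym p) (t₁ ∷ t₂ ∷ [])) → P t₁ × P t₂
  All-pair⁻ refl (pt₁ ∷ pt₂ ∷ []) = pt₁ , pt₂

  NF-const : (p : arity c ≡ 0) → NF (const c p)
  NF-const p = fun (no-args p) (λ _ → no-arg p)
    where
    no-args : ∀ {m} (q : m ≡ 0) → VAll.All NF (subst (Vec Term) (sym q) [])
    no-args refl = []
    no-arg : ∀ {m} {P : Term → Set} (q : m ≡ 0) → ¬ VAny.Any P (subst (Vec Term) (sym q) [])
    no-arg refl ()

  NF-bin⁻ : (p : arity f ≡ 2) → NF (bin f p t₁ t₂) → NF t₁ × NF t₂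
  NF-bin⁻ p (fun nfs _) = All-pair⁻ p nfs

  ¬symIn-args : ∀ {ts : Vec Term (arity f)} → ¬ c symIn fun f ts → VAll.All (λ t → ¬ c symIn t) ts
  ¬symIn-args {ts = ts} c∉ = ¬Any⇒All¬ᵥ ts (λ c∈ts → c∉ (there c∈ts))

  ¬symIn-bin⁻ : (p : arity f ≡ 2) → ¬ c symIn bin f p t₁ t₂ → ¬ c symIn t₁ × ¬ c symIn t₂
  ¬symIn-bin⁻ p c∉ = (λ c∈t₁ → c∉ (there (Any-pair⁺ p (inj₁ c∈t₁))))
                   , (λ c∈t₂ → c∉ (there (Any-pair⁺ p (inj₂ c∈t₂))))

  occursIn-var : z occursIn var y → z ≡ y
  occursIn-var here = refl

  ≡var⇒occursIn : t ≡ var y → y occursIn t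
  ≡var⇒occursIn refl = here

  ⟪⟫≡var⇒ : ∀ t → t ⟪ σ ⟫ ≡ var y → ∃ λ v → t ≡ var v × σ v ≡ var y
  ⟪⟫≡var⇒ (var v) σv≡y = v , refl , σv≡y

  mutual
    occursIn-⟪⟫⁻ : ∀ t σ → z occursIn (t ⟪ σ ⟫) → ∃ λ v → v occursIn t × z occursIn σ v
    occursIn-⟪⟫⁻ (var v)    σ z∈σv        = v , here , z∈σv
    occursIn-⟪⟫⁻ (fun f ts) σ (there z∈) with occursIn-substs⁻ ts σ z∈
    ... | v , v∈ts , z∈σv = v , there v∈ts , z∈σv

    occursIn-substs⁻ : ∀ (ts : Vec Term n) σ → VAny.Any (z occursIn_) (substs ts σ)
                     → ∃ λ v → VAny.Any (v occursIn_) ts × z occursIn σ v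
    occursIn-substs⁻ (t ∷ ts) σ (here z∈) with occursIn-⟪⟫⁻ t σ z∈
    ... | v , v∈t , z∈σv = v , here v∈t , z∈σv
    occursIn-substs⁻ (t ∷ ts) σ (there z∈) with occursIn-substs⁻ ts σ z∈
    ... | v , v∈ts , z∈σv = v , there v∈ts , z∈σv

  mutual
    occursIn-⟪⟫⁺ : ∀ {v} t σ → v occursIn t → z occursIn σ v → z occursIn (t ⟪ σ ⟫)
    occursIn-⟪⟫⁺ (var v)    σ here        z∈σv = z∈σv
    occursIn-⟪⟫⁺ (fun f ts) σ (there v∈) z∈σv = there (occursIn-substs⁺ ts σ v∈ z∈σv)

    occursIn-substs⁺ : ∀ {v} (ts : Vec Term n) σ → VAny.Any (v occursIn_) ts → z occursIn σ v
                     → VAny.Any (z occursIn_) (substs ts σ)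
    occursIn-substs⁺ (t ∷ ts) σ (here v∈)  z∈σv = here (occursIn-⟪⟫⁺ t σ v∈ z∈σv)
    occursIn-substs⁺ (t ∷ ts) σ (there v∈) z∈σv = there (occursIn-substs⁺ ts σ v∈ z∈σv)

  -- The arity is given up to an equation so that bin f p (var y₁) (var y₂) is an instance.
  funVars : (f : Fun) → arity f ≡ n → Vec ℕ n → Term
  funVars f p ys = fun f (subst (Vec Term) (sym p) (Vec.map var ys))

  occursIn-funVars⁻ : (p : arity f ≡ n) (ys : Vec ℕ n) → z occursIn funVars f p ys → z ∈ toList ys
  occursIn-funVars⁻ refl ys (there z∈) = go ys z∈
    where
    go : ∀ {m} (ys : Vec ℕ m) → VAny.Any (z occursIn_) (Vec.map var ys) → z ∈ toList ys
    go (y ∷ ys) (here here)  = here refl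
    go (y ∷ ys) (there z∈ys) = there (go ys z∈ys)

  occursIn-funVars⁺ : (p : arity f ≡ n) (ys : Vec ℕ n) → z ∈ toList ys → z occursIn funVars f p ys
  occursIn-funVars⁺ refl ys z∈ = there (go ys z∈)
    where
    go : ∀ {m} (ys : Vec ℕ m) → z ∈ toList ys → VAny.Any (z occursIn_) (Vec.map var ys)
    go (y ∷ ys) (here refl)  = here here
    go (y ∷ ys) (there z∈ys) = there (go ys z∈ys)

  ↦-self : ∀ x r → [ x ↦ r ] x ≡ r
  ↦-self x r with x ≟ x
  ... | yes _   = refl
  ... | no  x≢x = contradiction refl x≢x

  ↦-other : ∀ {x} r → z ≢ x → [ x ↦ r ] z ≡ var z
  ↦-other {z} {x} r z≢x with z ≟ x
  ... | yes z≡x = contradiction z≡x z≢x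
  ... | no  _   = refl

  module _ {x : ℕ} {r : Term} where

    Dom-bind⁻ : ∀ {w} → w ≢ x → Dom (θ ⨾ [ x ↦ r ]) w → Dom θ w
    Dom-bind⁻ w≢x dom θw≡w = dom (trans (cong (_⟪ [ x ↦ r ] ⟫) θw≡w) (↦-other r w≢x))

    -- Case splits test x ≟ v: with v ≟ x, `with` would also abstract the test inside the
    -- unfolded [ x ↦ r ] v, and ↦-self / ↦-other would no longer apply.
    Dom-bind⁺ : ∀ {w} → (∀ {z} → z occursIn r → ¬ Dom θ z) → Dom θ w → Dom (θ ⨾ [ x ↦ r ]) w
    Dom-bind⁺ {θ} {w} r∉Dom dom θwσ≡w with ⟪⟫≡var⇒ (θ w) θwσ≡w
    ... | v , θw≡v , σv≡w with x ≟ v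
    ...   | yes refl = r∉Dom (≡var⇒occursIn (trans (sym (↦-self x r)) σv≡w)) dom
    ...   | no  x≢v  = dom (trans θw≡v (trans (sym (↦-other r (x≢v ∘ sym))) σv≡w))

    FiniteDom-bind : FiniteDom θ → FiniteDom (θ ⨾ [ x ↦ r ])
    FiniteDom-bind {θ} (l , Dom⊆l) = x ∷ l , covered
      where
      covered : ∀ w → Dom (θ ⨾ [ x ↦ r ]) w → w ∈ x ∷ l
      covered w dom with x ≟ w
      ... | yes x≡w = here (sym x≡w)
      ... | no  x≢w = there (Dom⊆l w (Dom-bind⁻ {θ} (x≢w ∘ sym) dom))

    Rvar-bind⁻ : Rvar (θ ⨾ [ x ↦ r ]) z → (Rvar θ z × z ≢ x) ⊎ z occursIn r
    Rvar-bind⁻ {θ} {z} (w , dom , z∈θwσ) with occursIn-⟪⟫⁻ (θ w) [ x ↦ r ] z∈θwσ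
    ... | v , v∈θw , z∈σv with x ≟ v
    ...   | yes refl = inj₂ (subst (z occursIn_) (↦-self x r) z∈σv)
    ...   | no  x≢v with occursIn-var (subst (z occursIn_) (↦-other r (x≢v ∘ sym)) z∈σv)
    ...     | refl = inj₁ ((w , θw-moved , v∈θw) , x≢v ∘ sym)
      where
      -- θ w = var w would force w = v ≢ x, and the binding fixes such a w
      θw-moved : Dom θ w
      θw-moved θw≡w with occursIn-var (subst (z occursIn_) θw≡w v∈θw)
      ... | refl = Dom-bind⁻ {θ} (x≢v ∘ sym) dom θw≡w

    Rvar-bind⁺ˡ : (∀ {z} → z occursIn r → ¬ Dom θ z) → Rvar θ z → z ≢ x → Rvar (θ ⨾ [ x ↦ r ]) z
    Rvar-bind⁺ˡ {θ} {z} r∉Dom (w , dom , z∈θw) z≢x =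
      w , Dom-bind⁺ r∉Dom dom
        , occursIn-⟪⟫⁺ (θ w) [ x ↦ r ] z∈θw (≡var⇒occursIn (↦-other r z≢x))

    Rvar-bind⁺ʳ : (∀ {z} → z occursIn r → ¬ Dom θ z) → Rvar θ x → z occursIn r → Rvar (θ ⨾ [ x ↦ r ]) z
    Rvar-bind⁺ʳ {θ} {z} r∉Dom (w , dom , x∈θw) z∈r =
      w , Dom-bind⁺ r∉Dom dom
        , occursIn-⟪⟫⁺ (θ w) [ x ↦ r ] x∈θw (subst (z occursIn_) (sym (↦-self x r)) z∈r)

  record RangeLabels (θ : Subst) (L : List ℕ) : Set where
    field
      unique : Unique L
      ∉Dom   : ∀ z → z ∈ L → ¬ Dom θ z
      Rvar⇒∈ : ∀ z → Rvar θ z → z ∈ L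
      ∈⇒Rvar : ∀ z → z ∈ L → Rvar θ z
      finite : FiniteDom θ

  RangeLabels-resp-↭ : L ↭ N → RangeLabels θ L → RangeLabels θ N
  RangeLabels-resp-↭ L↭N rl = record
    { unique = Unique-resp-↭ L↭N unique
    ; ∉Dom   = λ z → ∉Dom z ∘ ∈-resp-↭ (↭-sym L↭N)
    ; Rvar⇒∈ = λ z → ∈-resp-↭ L↭N ∘ Rvar⇒∈ z
    ; ∈⇒Rvar = λ z → ∈⇒Rvar z ∘ ∈-resp-↭ (↭-sym L↭N)
    ; finite = finite
    }
    where open RangeLabels rl

  RangeLabels-bind : ∀ {x r} → RangeLabels θ (x ∷ L)
    → Unique N → Disjoint N (x ∷ L) → (∀ {z} → z ∈ N → ¬ Dom θ z)
    → (∀ {z} → z occursIn r → z ∈ N ++ L) → (∀ {z} → z ∈ N → z occursIn r)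
    → RangeLabels (θ ⨾ [ x ↦ r ]) (N ++ L)
  RangeLabels-bind {θ} {L} {N} {x} {r} rl uN N#x∷L N∉Dom r⊆N++L N⊆r = record
    { unique = Unique-++⁺ uN (tail unique) (λ (z∈N , z∈L) → N#x∷L (z∈N , there z∈L))
    ; ∉Dom   = λ z z∈ → proj₂ (fresh z∈) ∘ Dom-bind⁻ {r = r} {θ = θ} (proj₁ (fresh z∈))
    ; Rvar⇒∈ = Rvar⇒∈′
    ; ∈⇒Rvar = ∈⇒Rvar′
    ; finite = FiniteDom-bind finite
    }
    where
    open RangeLabels rl
    tail : ∀ {l} → Unique (x ∷ l) → Unique l
    tail (_ ∷ u) = u
    fresh : ∀ {z} → z ∈ N ++ L → z ≢ x × ¬ Dom θ z
    fresh {z} z∈ with ∈-++⁻ N z∈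
    ... | inj₁ z∈N = (λ { refl → N#x∷L (z∈N , here refl) }) , N∉Dom z∈N
    ... | inj₂ z∈L = (λ { refl → Unique[x∷xs]⇒x∉xs unique z∈L }) , ∉Dom z (there z∈L)
    r∉Dom : ∀ {z} → z occursIn r → ¬ Dom θ z
    r∉Dom = proj₂ ∘ fresh ∘ r⊆N++L
    Rvar⇒∈′ : ∀ z → Rvar (θ ⨾ [ x ↦ r ]) z → z ∈ N ++ L
    Rvar⇒∈′ z rv with Rvar-bind⁻ rv
    ... | inj₂ z∈r = r⊆N++L z∈r
    ... | inj₁ (rvθ , z≢x) with Rvar⇒∈ z rvθ
    ...   | here z≡x  = contradiction z≡x z≢x
    ...   | there z∈L = ∈-++⁺ʳ N z∈L
    ∈⇒Rvar′ : ∀ z → z ∈ N ++ L → Rvar (θ ⨾ [ x ↦ r ]) z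
    ∈⇒Rvar′ z z∈ with ∈-++⁻ N z∈
    ... | inj₁ z∈N = Rvar-bind⁺ʳ r∉Dom (∈⇒Rvar x (here refl)) (N⊆r z∈N)
    ... | inj₂ z∈L = Rvar-bind⁺ˡ r∉Dom (∈⇒Rvar z (there z∈L)) (proj₁ (fresh z∈))

  NormalAUE : AUE → Set
  NormalAUE a = NF (lhs a) × NF (rhs a)

  StarFreeAUE : AUE → Set
  StarFreeAUE a = ¬ ⋆ symIn lhs a × ¬ ⋆ symIn rhs a

  StarFreeAUE⇒¬Wild : ∀ {a} → StarFreeAUE a → ¬ Wild a
  StarFreeAUE⇒¬Wild (⋆∉lhs , _) (inj₁ lhs≡⋆) = ⋆∉lhs (subst (⋆ symIn_) (sym lhs≡⋆) here)
  StarFreeAUE⇒¬Wild (_ , ⋆∉rhs) (inj₂ rhs≡⋆) = ⋆∉rhs (subst (⋆ symIn_) (sym rhs≡⋆) here)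

  labels-++ : ∀ (W₁ W₂ : List AUE) → labels (W₁ ++ W₂) ≡ labels W₁ ++ labels W₂
  labels-++ = map-++ lab

  labels-↭ : ∀ {W₁ W₂} → W₁ ↭ W₂ → labels W₁ ↭ labels W₂
  labels-↭ = map⁺ lab

  labels-allAUEs : ∀ A S T → labels (A ++ S ++ T) ≡ labels A ++ labels S ++ labels T
  labels-allAUEs A S T = trans (labels-++ A (S ++ T)) (cong (labels A ++_) (labels-++ S T))

  rangeLabels : ∀ {A S T θ} → IsConfiguration ⟨ A ﹔ S ﹔ T ﹔ θ ⟩ → RangeLabels θ (labels (A ++ S ++ T))
  rangeLabels {A} {S} {T} cfg = record
    { unique = subst Unique (sym (labels-allAUEs A S T))
        (Unique-++⁺ validA (Unique-++⁺ validS validT disjST) (Disjoint-++⁺ʳ disjAS disjAT))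
    ; ∉Dom   = disjDom
    ; Rvar⇒∈ = rvar⇒lab
    ; ∈⇒Rvar = lab⇒rvar
    ; finite = finite
    }
    where open IsConfiguration cfg

  configuration : RangeLabels θ (labels (A ++ S ++ T)) → All Solved S → All Wild T
                → All NormalAUE (A ++ S ++ T) → IsConfiguration ⟨ A ﹔ S ﹔ T ﹔ θ ⟩
  configuration {θ} {A} {S} {T} rl solved wild normal =
    let uA , uS++T , A#S++T = Unique-++⁻ (labels A) (subst Unique (labels-allAUEs A S T) unique)
        uS , uT , S#T = Unique-++⁻ (labels S) uS++T
        A#S , A#T = Disjoint-++⁻ʳ A#S++T
    in record
      { validA   = uA
      ; validS   = uS
      ; validT   = uT
      ; solvedS  = solved
      ; wildT    = wild
      ; normal   = normal
      ; disjAS   = A#S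
      ; disjAT   = A#T
      ; disjST   = S#T
      ; disjDom  = ∉Dom
      ; rvar⇒lab = Rvar⇒∈
      ; lab⇒rvar = ∈⇒Rvar
      ; finite   = finite
      }
    where open RangeLabels rl

  normal-selected : ∀ {θ} → IsConfiguration ⟨ A ﹔ S ﹔ T ﹔ θ ⟩ → A ↭ e ∷ A₀ → NormalAUE e
  normal-selected {A} cfg A↭e∷A₀ = proj₁ (All-↭-∷⁻ A↭e∷A₀ (All.++⁻ˡ A (IsConfiguration.normal cfg)))

  configuration-Sol : ∀ {a} → IsConfiguration ⟨ A ﹔ S ﹔ T ﹔ θ ⟩ → StarFreeA ⟨ A ﹔ S ﹔ T ﹔ θ ⟩
    → A ↭ a ∷ A₀ → head (lhs a) ≢ head (rhs a) → ¬ Related (head (lhs a)) (head (rhs a))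
    → IsConfiguration ⟨ A₀ ﹔ a ∷ S ﹔ T ﹔ θ ⟩
  configuration-Sol {A} {S} {T} {A₀ = A₀} {a} cfg starFree A↭a∷A₀ heads≢ ¬related =
    configuration
      (RangeLabels-resp-↭ (labels-↭ moved) (rangeLabels cfg))
      ((heads≢ , ¬related , StarFreeAUE⇒¬Wild {a} (proj₁ (All-↭-∷⁻ A↭a∷A₀ starFree))) ∷ solvedS)
      wildT
      (All-resp-↭ moved normal)
    where
    open IsConfiguration cfg
    moved : A ++ S ++ T ↭ A₀ ++ a ∷ S ++ T
    moved = ↭-trans (++⁺ʳ (S ++ T) A↭a∷A₀) (↭-sym (shift a A₀ (S ++ T)))

  configuration-Mer : ∀ {x} → IsConfiguration ⟨ [] ﹔ S ﹔ T ﹔ θ ⟩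
    → S ↭ (s ≜[ x ] t) ∷ (s ≜[ y ] t) ∷ S₀
    → IsConfiguration ⟨ [] ﹔ (s ≜[ y ] t) ∷ S₀ ﹔ T ﹔ θ ⨾ [ x ↦ var y ] ⟩
  configuration-Mer {T = T} cfg S↭ =
    configuration
      (RangeLabels-bind (RangeLabels-resp-↭ (labels-↭ merged) (rangeLabels cfg))
        [] (λ { (() , _) }) (λ ()) (λ { here → here refl }) (λ ()))
      (proj₂ (All-↭-∷⁻ S↭ solvedS))
      wildT
      (proj₂ (All-↭-∷⁻ merged normal))
    where
    open IsConfiguration cfg
    merged = ++⁺ʳ T S↭

  configuration-expand : ∀ {f} (p : arity f ≡ n) (ys : Vec ℕ n) (D W : List AUE)
    → IsConfiguration ⟨ A ﹔ S ﹔ T ﹔ θ ⟩ → A ↭ e ∷ A₀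
    → labels (W ++ D) ↭ toList ys → Unique (toList ys) → VAll.All (Fresh ⟨ A ﹔ S ﹔ T ﹔ θ ⟩) ys
    → All NormalAUE D → All NormalAUE W → All Wild W
    → IsConfiguration ⟨ D ++ A₀ ﹔ S ﹔ W ++ T ﹔ θ ⨾ [ lab e ↦ funVars f p ys ] ⟩
  configuration-expand {A = A} {S} {T} {θ} {e} {A₀} p ys D W cfg A↭e∷A₀ new↭ys uys fresh
                       normalD normalW wildW =
    configuration
      (RangeLabels-resp-↭ relabelled
        (RangeLabels-bind old (Unique-resp-↭ (↭-sym new↭ys) uys) new#old
          (proj₁ ∘ proj₂ ∘ fresh′)
          (∈-++⁺ˡ ∘ ∈-resp-↭ (↭-sym new↭ys) ∘ occursIn-funVars⁻ p ys)
          (occursIn-funVars⁺ p ys ∘ ∈-resp-↭ new↭ys)))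
      solvedS
      (All.++⁺ wildW wildT)
      (All-resp-↭ (↭-sym rearranged)
        (All.++⁺ (All.++⁺ normalW normalD) (proj₂ (All-↭-∷⁻ removed normal))))
    where
    open IsConfiguration cfg
    R = A₀ ++ S ++ T
    removed : A ++ S ++ T ↭ e ∷ R
    removed = ++⁺ʳ (S ++ T) A↭e∷A₀
    rearranged : (D ++ A₀) ++ S ++ W ++ T ↭ (W ++ D) ++ R
    rearranged = begin
      (D ++ A₀) ++ S ++ W ++ T  ≡⟨ ++-assoc D A₀ (S ++ W ++ T) ⟩
      D ++ A₀ ++ S ++ W ++ T    ≡⟨ cong (D ++_) (sym (++-assoc A₀ S (W ++ T))) ⟩
      D ++ (A₀ ++ S) ++ W ++ T  ↭⟨ ++⁺ˡ D (shifts (A₀ ++ S) W) ⟩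
      D ++ W ++ (A₀ ++ S) ++ T  ↭⟨ shifts D W ⟩
      W ++ D ++ (A₀ ++ S) ++ T  ≡⟨ cong (λ l → W ++ D ++ l) (++-assoc A₀ S T) ⟩
      W ++ D ++ R               ≡⟨ sym (++-assoc W D R) ⟩
      (W ++ D) ++ R             ∎
      where open PermutationReasoning
    old : RangeLabels θ (lab e ∷ labels R)
    old = RangeLabels-resp-↭ (labels-↭ removed) (rangeLabels cfg)
    relabelled : labels (W ++ D) ++ labels R ↭ labels ((D ++ A₀) ++ S ++ W ++ T)
    relabelled = ↭-trans (↭-reflexive (sym (labels-++ (W ++ D) R))) (labels-↭ (↭-sym rearranged))
    fresh′ : ∀ {z} → z ∈ labels (W ++ D) → Fresh ⟨ A ﹔ S ﹔ T ﹔ θ ⟩ z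
    fresh′ z∈ = All.lookup (VAll.toList⁺ fresh) (∈-resp-↭ new↭ys z∈)
    new#old : Disjoint (labels (W ++ D)) (lab e ∷ labels R)
    new#old (z∈new , z∈old) = proj₁ (fresh′ z∈new) (∈-resp-↭ (↭-sym (labels-↭ removed)) z∈old)

  configuration-Exp : ∀ {f y₁ y₂ a₁ a₂} (p : arity f ≡ 2)
    → IsConfiguration ⟨ A ﹔ S ﹔ T ﹔ θ ⟩ → A ↭ e ∷ A₀
    → lab a₂ ∷ lab a₁ ∷ [] ↭ y₁ ∷ y₂ ∷ [] → y₁ ≢ y₂
    → Fresh ⟨ A ﹔ S ﹔ T ﹔ θ ⟩ y₁ → Fresh ⟨ A ﹔ S ﹔ T ﹔ θ ⟩ y₂
    → NormalAUE a₁ → NormalAUE a₂ → Wild a₂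
    → IsConfiguration ⟨ a₁ ∷ A₀ ﹔ S ﹔ a₂ ∷ T ﹔ θ ⨾ [ lab e ↦ bin f p (var y₁) (var y₂) ] ⟩
  configuration-Exp {y₁ = y₁} {y₂} {a₁} {a₂} p cfg A↭e∷A₀ new↭ys y₁≢y₂ fresh₁ fresh₂ normal₁ normal₂ wild₂ =
    configuration-expand p (y₁ ∷ y₂ ∷ []) (a₁ ∷ []) (a₂ ∷ []) cfg A↭e∷A₀ new↭ys
      ((y₁≢y₂ ∷ []) ∷ [] ∷ []) (fresh₁ ∷ fresh₂ ∷ []) (normal₁ ∷ []) (normal₂ ∷ []) (wild₂ ∷ [])

  decAUEs-All : ∀ {P Q : Term → Set} (ss : Vec Term n) (ys : Vec ℕ n) (ts : Vec Term n)
    → VAll.All P ss → VAll.All Q ts → All (λ a → P (lhs a) × Q (rhs a)) (decAUEs ss ys ts)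
  decAUEs-All []       []       []       []         []         = []
  decAUEs-All (s ∷ ss) (y ∷ ys) (t ∷ ts) (ps ∷ pss) (qt ∷ qts) = (ps , qt) ∷ decAUEs-All ss ys ts pss qts

  labels-decAUEs : (ss : Vec Term n) (ys : Vec ℕ n) (ts : Vec Term n) → labels (decAUEs ss ys ts) ≡ toList ys
  labels-decAUEs []       []       []       = refl
  labels-decAUEs (s ∷ ss) (y ∷ ys) (t ∷ ts) = cong (y ∷_) (labels-decAUEs ss ys ts)

  ⟹-preserves-StarFreeA : ∀ {C C'} → C ⟹ C' → StarFreeA C → StarFreeA C'
  ⟹-preserves-StarFreeA (Dec {ss = ss} {ts} ys A↭ _ _) starFree
    with All-↭-∷⁻ A↭ starFree
  ... | (⋆∉ss , ⋆∉ts) , starFree₀ =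
    All.++⁺ (decAUEs-All ss ys ts (¬symIn-args ⋆∉ss) (¬symIn-args ⋆∉ts)) starFree₀
  ⟹-preserves-StarFreeA (Sol A↭ _ _) starFree = proj₂ (All-↭-∷⁻ A↭ starFree)
  ⟹-preserves-StarFreeA (ExpLA1 m A↭ _ _ _) starFree with All-↭-∷⁻ A↭ starFree
  ... | (⋆∉ε , ⋆∉b) , starFree₀ = (⋆∉ε , proj₁ (¬symIn-bin⁻ (binary m) ⋆∉b)) ∷ starFree₀
  ⟹-preserves-StarFreeA (ExpLA2 m A↭ _ _ _) starFree with All-↭-∷⁻ A↭ starFree
  ... | (⋆∉ε , ⋆∉b) , starFree₀ = (⋆∉ε , proj₂ (¬symIn-bin⁻ (binary m) ⋆∉b)) ∷ starFree₀
  ⟹-preserves-StarFreeA (ExpRA1 m A↭ _ _ _) starFree with All-↭-∷⁻ A↭ starFree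
  ... | (⋆∉b , ⋆∉ε) , starFree₀ = (proj₁ (¬symIn-bin⁻ (binary m) ⋆∉b) , ⋆∉ε) ∷ starFree₀
  ⟹-preserves-StarFreeA (ExpRA2 m A↭ _ _ _) starFree with All-↭-∷⁻ A↭ starFree
  ... | (⋆∉b , ⋆∉ε) , starFree₀ = (proj₂ (¬symIn-bin⁻ (binary m) ⋆∉b) , ⋆∉ε) ∷ starFree₀
  ⟹-preserves-StarFreeA (Mer _) _ = []

  ⟹-preserves-IsConfiguration : ∀ {C C'} → C ⟹ C' → IsConfiguration C → StarFreeA C → IsConfiguration C'
  ⟹-preserves-IsConfiguration (Dec {ss = ss} {ts} ys A↭ uys fresh) cfg _
    with normal-selected cfg A↭
  ... | fun normalss _ , fun normalts _ =
    configuration-expand refl ys (decAUEs ss ys ts) [] cfg A↭ (↭-reflexive (labels-decAUEs ss ys ts))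
      uys fresh (decAUEs-All ss ys ts normalss normalts) [] []
  ⟹-preserves-IsConfiguration (Sol A↭ heads≢ ¬related) cfg starFree =
    configuration-Sol cfg starFree A↭ heads≢ ¬related
  ⟹-preserves-IsConfiguration (ExpLA1 m A↭ y₁≢y₂ fresh₁ fresh₂) cfg _
    with normal-selected cfg A↭
  ... | normalε , normalb with NF-bin⁻ (binary m) normalb
  ...   | normal₁ , normal₂ = configuration-Exp (binary m) cfg A↭ (↭-swap _ _ ↭-refl) y₁≢y₂ fresh₁ fresh₂
                                (normalε , normal₁) (NF-const ⋆-const , normal₂) (inj₁ refl)
  ⟹-preserves-IsConfiguration (ExpLA2 m A↭ y₁≢y₂ fresh₁ fresh₂) cfg _
    with normal-selected cfg A↭
  ... | normalε , normalb with NF-bin⁻ (binary m) normalb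
  ...   | normal₁ , normal₂ = configuration-Exp (binary m) cfg A↭ ↭-refl y₁≢y₂ fresh₁ fresh₂
                                (normalε , normal₂) (NF-const ⋆-const , normal₁) (inj₁ refl)
  ⟹-preserves-IsConfiguration (ExpRA1 m A↭ y₁≢y₂ fresh₁ fresh₂) cfg _
    with normal-selected cfg A↭
  ... | normalb , normalε with NF-bin⁻ (binary m) normalb
  ...   | normal₁ , normal₂ = configuration-Exp (binary m) cfg A↭ (↭-swap _ _ ↭-refl) y₁≢y₂ fresh₁ fresh₂
                                (normal₁ , normalε) (normal₂ , NF-const ⋆-const) (inj₂ refl)
  ⟹-preserves-IsConfiguration (ExpRA2 m A↭ y₁≢y₂ fresh₁ fresh₂) cfg _
    with normal-selected cfg A↭
  ... | normalb , normalε with NF-bin⁻ (binary m) normalb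
  ...   | normal₁ , normal₂ = configuration-Exp (binary m) cfg A↭ ↭-refl y₁≢y₂ fresh₁ fresh₂
                                (normal₂ , normalε) (normal₁ , NF-const ⋆-const) (inj₂ refl)
  ⟹-preserves-IsConfiguration (Mer S↭) cfg _ = configuration-Mer cfg S↭

lemma1 : (sig : Signature) (ab : AbsTheory sig)
    → let open AU sig ab in
      (C C' : Quad) → IsConfiguration C → StarFreeA C
      → Star _⟹_ C C' → IsConfiguration C'
lemma1 sig ab _ _  cfg _        ε              = cfg
lemma1 sig ab _ C' cfg starFree (step ◅ steps) =
  lemma1 sig ab _ C' (⟹-preserves-IsConfiguration sig ab step cfg starFree)
    (⟹-preserves-StarFreeA sig ab step starFree) steps
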